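{- There exists a family $(L_n)_{n\ge 2}$ of $\omega$-languages, where $L_n$ is over an alphabet of $n$ letters, such that for every $n\ge2$ the language $L_n$ is recognized by a limit-deterministic Büchi automaton with $3n+2$ states but is not recognized by any deterministic parity automaton with fewer than $n!$ states.
   Context: A (transition-based) Büchi automaton $(Q,q_0,\Sigma,\delta,\alpha)$ has finite state set $Q$, initial state $q_0$, total transition relation $\delta\subseteq Q\times\Sigma\times Q$ and accepting transitions $\alpha\subseteq\delta$; it accepts $w\in\Sigma^\omega$ if some run on $w$ uses accepting transitions infinitely often. It is limit-deterministic if there is $Q_d\subseteq Q$ with $\alpha\subseteq Q_d\times\Sigma\times Q_d$, each state of $Q_d$ having at most one $\sigma$-successor for each letter $\sigma$, and all successors of $Q_d$-states lying in $Q_d$. A deterministic parity automaton has a deterministic transition function and assigns a positive integer color to each transition; a word is accepted iff the minimal color seen infinitely often along its run is even. -}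

module Defs where

open import Data.Nat using (ℕ; zero; suc; _+_; _*_; _≤_; _<_; _≥_)
open import Data.Nat.Divisibility using (_∣_)
open import Data.Fin using (Fin)
open import Data.Bool using (Bool; true; false)
open import Data.Product using (Σ; ∃; ∃-syntax; _×_; _,_)
open import Relation.Binary.PropositionalEquality using (_≡_)
open import Relation.Nullary using (¬_)
open import Function.Bundles using (_⇔_)

Word : ℕ → Set
Word n = ℕ → Fin n

Language : ℕ → Set₁
Language n = Word n → Set

InfinitelyOften : (ℕ → Set) → Set
InfinitelyOften P = ∀ i → ∃[ j ] (i ≤ j × P j)

Eventually : (ℕ → Set) → Set
Eventually P = ∃[ N ] (∀ j → N ≤ j → P j)

-- Transition-based (nondeterministic) Büchi automata with k states
-- Q = Fin k, Σ = Fin n; δ and α are given as Boolean characteristic functions.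

record Buchi (k n : ℕ) : Set where
  field
    init   : Fin k
    δ      : Fin k → Fin n → Fin k → Bool
    α      : Fin k → Fin n → Fin k → Bool
    total  : ∀ q a → ∃[ q' ] (δ q a q' ≡ true)
    α⊆δ    : ∀ q a q' → α q a q' ≡ true → δ q a q' ≡ true

module _ {k n : ℕ} (A : Buchi k n) where
  open Buchi A

  IsRun : Word n → (ℕ → Fin k) → Set
  IsRun w r = r 0 ≡ init × (∀ i → δ (r i) (w i) (r (suc i)) ≡ true)

  BuchiAccepts : Word n → Set
  BuchiAccepts w = ∃[ r ] (IsRun w r × InfinitelyOften (λ i → α (r i) (w i) (r (suc i)) ≡ true))

  LimitDeterministic : Set
  LimitDeterministic =
    Σ (Fin k → Bool) λ Qd →
            ( (∀ q a q' → α q a q' ≡ true → (Qd q ≡ true × Qd q' ≡ true))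
            × (∀ q a q₁ q₂ → Qd q ≡ true → δ q a q₁ ≡ true → δ q a q₂ ≡ true → q₁ ≡ q₂)
            × (∀ q a q' → Qd q ≡ true → δ q a q' ≡ true → Qd q' ≡ true) )

record DPA (m n : ℕ) : Set where
  field
    init      : Fin m
    δ         : Fin m → Fin n → Fin m
    color     : Fin m → Fin n → ℕ
    color-pos : ∀ q a → 1 ≤ color q a

module _ {m n : ℕ} (D : DPA m n) where
  open DPA D

  dpaRun : Word n → ℕ → Fin m
  dpaRun w zero    = init
  dpaRun w (suc i) = δ (dpaRun w i) (w i)

  colorAt : Word n → ℕ → ℕ
  colorAt w i = color (dpaRun w i) (w i)

  -- the minimal colour seen infinitely often is even: some even c is seen
  -- infinitely often and eventually all colours are ≥ c
  DPAAccepts : Word n → Set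
  DPAAccepts w = ∃[ c ] ( 2 ∣ c
                        × InfinitelyOften (λ i → colorAt w i ≡ c)
                        × Eventually (λ i → c ≤ colorAt w i) )

BuchiRecognizes : {k n : ℕ} → Buchi k n → Language n → Set
BuchiRecognizes A L = ∀ w → L w ⇔ BuchiAccepts A w

DPARecognizes : {m n : ℕ} → DPA m n → Language n → Set
DPARecognizes D L = ∀ w → L w ⇔ DPAAccepts D w

-- L n consists of the ω-words in which some letter a occurs infinitely often but, from some point
-- on, never twice in a row. A limit-deterministic automaton guesses a and that point, and then checks
-- the word with one pair of deterministic states (waiting for a, just read a) per letter.
-- For the lower bound, an ordering c₁ c₂ … cₖ of the letters is encoded by the block
-- (c₁ d w)^(m!), where d lists each of c₂ … cₖ twice and w encodes the ordering c₂ … cₖ; the exponent m!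
-- makes every block loop at the state a DPA with m states reaches after it. If two orderings led to the
-- same state, two blocks with different leading letters would be loops at that state. Each loop alone
-- spells a word of L, so its minimal colour is even; hence so is the minimal colour of the concatenated
-- loop, in which every letter occurs doubled, so the DPA accepts a word outside L. Thus the n! orderings
-- reach n! distinct states.
module Submission where

open import Defs
open import Data.Nat using (ℕ; zero; suc; _+_; _*_; _∸_; _≤_; _<_; _⊔_; _!; pred; z≤n; s≤s)
open import Data.Nat.Properties hiding (_≟_)
open import Data.Nat.Divisibility using (_∣_; divides; m∣m*n; ∣-trans; ∣⇒≤; m≤n⇒m!∣n!)
open import Data.Nat.DivMod using (_%_; _/_; m≡m%n+[m/n]*n; m%n<n)
open import Algebra.Properties.CommutativeSemigroup +-commutativeSemigroup using (x∙yz≈y∙xz)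
open import Data.Nat.GeneralisedArithmetic using (fold; fold-+)
open import Data.Fin using (Fin; zero; suc; toℕ; punchIn; punchOut; remQuot; combine; splitAt; _↑ˡ_; _↑ʳ_)
open import Data.Fin.Properties
  using ( _≟_; pigeonhole; toℕ<n; punchInᵢ≢i; punchIn-injective; punchIn-punchOut; combine-remQuot
        ; splitAt-↑ˡ; splitAt-↑ʳ)
open import Data.Bool using (Bool; true; false; _∧_)
open import Data.List using (List; []; _∷_; _++_; [_]; length)
open import Data.List.Properties using (++-assoc; ++-identityʳ)
open import Data.List.Relation.Unary.All as All using (All; []; _∷_; head; tail)
open import Data.List.Relation.Unary.All.Properties using (++⁺)
open import Data.List.Relation.Unary.Any using (here; there)
open import Data.List.Relation.Unary.Any.Properties using (++⁺ˡ; ++⁺ʳ)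
open import Data.List.Membership.Propositional using (_∈_)
open import Data.Sum using (inj₁; inj₂; [_,_]′)
open import Data.Product using (Σ; ∃-syntax; _×_; _,_; proj₁; proj₂; uncurry)
open import Data.Empty using (⊥-elim)
open import Function using (_∘_; id)
open import Function.Bundles using (Equivalence; mk⇔)
open import Function.Definitions using (Injective)
open import Relation.Binary.PropositionalEquality hiding ([_])
open import Relation.Nullary using (¬_; Dec; yes; no; does)
open import Relation.Nullary.Decidable using (dec-true)

module _ {A : Set} where

  prepend : List A → (ℕ → A) → ℕ → A
  prepend []      f p       = f p
  prepend (a ∷ u) f zero    = a
  prepend (a ∷ u) f (suc p) = prepend u f p

  prepend-+ : ∀ u f p → prepend u f (length u + p) ≡ f p
  prepend-+ []      f p = refl
  prepend-+ (a ∷ u) f p = prepend-+ u f p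

  All-prepend : ∀ {P : A → Set} u f {p} → All P u → p < length u → P (prepend u f p)
  All-prepend (a ∷ u) f {zero}  (pa ∷ _)  _         = pa
  All-prepend (a ∷ u) f {suc p} (_  ∷ pu) (s≤s p<u) = All-prepend u f pu p<u

  cycleFrom : A → List A → List A → ℕ → A
  cycleFrom a as []       zero    = a
  cycleFrom a as []       (suc p) = cycleFrom a as as p
  cycleFrom a as (b ∷ bs) zero    = b
  cycleFrom a as (b ∷ bs) (suc p) = cycleFrom a as bs p

  cycle : A → List A → ℕ → A
  cycle a as = cycleFrom a as (a ∷ as)

  cycleFrom-prepend : ∀ a as u p → cycleFrom a as u p ≡ prepend u (cycle a as) p
  cycleFrom-prepend a as []       zero    = refl
  cycleFrom-prepend a as []       (suc p) = refl
  cycleFrom-prepend a as (b ∷ bs) zero    = refl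
  cycleFrom-prepend a as (b ∷ bs) (suc p) = cycleFrom-prepend a as bs p

  cycle-unfold : ∀ a as p → cycle a as p ≡ prepend (a ∷ as) (cycle a as) p
  cycle-unfold a as = cycleFrom-prepend a as (a ∷ as)

  cycle-periodic : ∀ a as p → cycle a as (length (a ∷ as) + p) ≡ cycle a as p
  cycle-periodic a as p = trans (cycle-unfold a as (length (a ∷ as) + p)) (prepend-+ (a ∷ as) (cycle a as) p)

data Adj {A : Set} (b c : A) : List A → Set where
  here  : ∀ {u} → Adj b c (b ∷ c ∷ u)
  there : ∀ {x u} → Adj b c u → Adj b c (x ∷ u)

module _ {A : Set} where

  cycle-Adj : ∀ (a : A) as {r} → r < length (a ∷ as) → Adj (cycle a as r) (cycle a as (suc r)) ((a ∷ as) ++ [ a ])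
  cycle-Adj a as = cycleFrom-Adj (a ∷ as)
    where
    cycleFrom-Adj : ∀ u {r} → r < length u → Adj (cycleFrom a as u r) (cycleFrom a as u (suc r)) (u ++ [ a ])
    cycleFrom-Adj (b ∷ [])    {zero}  _         = here
    cycleFrom-Adj (b ∷ c ∷ u) {zero}  _         = here
    cycleFrom-Adj (b ∷ u)     {suc r} (s≤s r<u) = there (cycleFrom-Adj u r<u)

  Adj⇒prepend : ∀ {b c : A} {u} → Adj b c u →
                ∃[ r ] (suc r < length u × (∀ f → prepend u f r ≡ b × prepend u f (suc r) ≡ c))
  Adj⇒prepend here = 0 , s≤s (s≤s z≤n) , λ f → refl , refl
  Adj⇒prepend (there adj) with Adj⇒prepend adj
  ... | r , r<u , at = suc r , s≤s r<u , at

  Adj-++ˡ : ∀ {b c : A} {u} v → Adj b c u → Adj b c (u ++ v)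
  Adj-++ˡ v here        = here
  Adj-++ˡ v (there adj) = there (Adj-++ˡ v adj)

  Adj-++ʳ : ∀ {b c : A} u {v} → Adj b c v → Adj b c (u ++ v)
  Adj-++ʳ []      adj = adj
  Adj-++ʳ (x ∷ u) adj = there (Adj-++ʳ u adj)

  ¬Adj-∷ : ∀ {a x : A} {u} → x ≢ a → ¬ Adj a a u → ¬ Adj a a (x ∷ u)
  ¬Adj-∷ x≢a ¬adj here        = x≢a refl
  ¬Adj-∷ x≢a ¬adj (there adj) = ¬adj adj

  ¬Adj-++ : ∀ {a : A} u {v} → All (_≢ a) u → ¬ Adj a a v → ¬ Adj a a (u ++ v)
  ¬Adj-++ []      []           ¬adj = ¬adj
  ¬Adj-++ (x ∷ u) (x≢a ∷ u≢a) ¬adj = ¬Adj-∷ x≢a (¬Adj-++ u u≢a ¬adj)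

module _ {A : Set} where

  power : ℕ → List A → List A
  power zero    v = []
  power (suc t) v = v ++ power t v

  power-+ : ∀ s t v → power (s + t) v ≡ power s v ++ power t v
  power-+ zero    t v = refl
  power-+ (suc s) t v = trans (cong (v ++_) (power-+ s t v)) (sym (++-assoc v (power s v) _))

  power-suc : ∀ t v → power (suc t) v ≡ power t v ++ v
  power-suc t v = trans (cong (λ k → power k v) (+-comm 1 t))
                    (trans (power-+ t 1 v) (cong (power t v ++_) (++-identityʳ v)))

  All-power : ∀ {P : A → Set} t {v} → All P v → All P (power t v)
  All-power zero    pv = []
  All-power (suc t) pv = ++⁺ pv (All-power t pv)

  ¬Adj-power : ∀ {a y : A} {u} t → y ≢ a → All (_≢ a) u → ¬ Adj a a (power t (a ∷ y ∷ u) ++ [ a ])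
  ¬Adj-power zero    y≢a u≢a (there ())
  ¬Adj-power {a} {y} {u} (suc t) y≢a u≢a adj =
    ¬Adj-head (subst (Adj a a) (++-assoc (a ∷ y ∷ u) (power t (a ∷ y ∷ u)) [ a ]) adj)
    where
    ¬Adj-head : ¬ Adj a a (a ∷ y ∷ (u ++ (power t (a ∷ y ∷ u) ++ [ a ])))
    ¬Adj-head here          = y≢a refl
    ¬Adj-head (there adj′) = ¬Adj-∷ y≢a (¬Adj-++ u u≢a (¬Adj-power t y≢a u≢a)) adj′

module Periodic {B : Set} (h : ℕ → B) (P-1 : ℕ) (periodic : ∀ p → h (suc P-1 + p) ≡ h p) where
  P : ℕ
  P = suc P-1

  periodic-* : ∀ t r → h (t * P + r) ≡ h r
  periodic-* zero    r = refl
  periodic-* (suc t) r = trans (cong h (+-assoc P (t * P) r)) (trans (periodic _) (periodic-* t r))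

  split : ∀ p → ∃[ t ] ∃[ r ] (r < P × p ≡ t * P + r)
  split p = p / P , p % P , m%n<n p P , trans (m≡m%n+[m/n]*n p P) (+-comm (p % P) _)

  residue : ∀ p → ∃[ r ] (r < P × h p ≡ h r)
  residue p with split p
  ... | t , r , r<P , p≡ = r , r<P , trans (cong h p≡) (periodic-* t r)

  t≤x+[t*P+r] : ∀ x t r → t ≤ x + (t * P + r)
  t≤x+[t*P+r] x t r = ≤-trans (m≤m*n t P) (≤-trans (m≤m+n (t * P) r) (m≤n+m (t * P + r) x))

module Runs {S : Set} {n : ℕ} (δ : S → Fin n → S) where
  run : S → List (Fin n) → S
  run q []      = q
  run q (a ∷ u) = run (δ q a) u

  run-++ : ∀ q u v → run q (u ++ v) ≡ run (run q u) v
  run-++ q []      v = refl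
  run-++ q (a ∷ u) v = run-++ (δ q a) u v

  run-power : ∀ q v t → run q (power t v) ≡ fold q (λ p → run p v) t
  run-power q v zero    = refl
  run-power q v (suc t) = begin
    run q (power (suc t) v)     ≡⟨ cong (run q) (power-suc t v) ⟩
    run q (power t v ++ v)      ≡⟨ run-++ q (power t v) v ⟩
    run (run q (power t v)) v   ≡⟨ cong (λ p → run p v) (run-power q v t) ⟩
    fold q (λ p → run p v) (suc t) ∎
    where open ≡-Reasoning

module _ {X : Set} (φ : X → X) (x : X) where

  fold-periodic : ∀ {a b} → a ≤ b → fold x φ a ≡ fold x φ b →
                  ∀ t N → a ≤ N → fold x φ (t * (b ∸ a) + N) ≡ fold x φ N
  fold-periodic {a} {b} a≤b φᵃ≡φᵇ zero    N a≤N = refl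
  fold-periodic {a} {b} a≤b φᵃ≡φᵇ (suc t) N a≤N = begin
    fold x φ ((d + t * d) + N)         ≡⟨ cong (fold x φ) (+-assoc d (t * d) N) ⟩
    fold x φ (d + M)                    ≡⟨ cong (λ k → fold x φ (d + k)) (sym (m∸n+n≡m a≤M)) ⟩
    fold x φ (d + ((M ∸ a) + a))        ≡⟨ cong (fold x φ) (x∙yz≈y∙xz d (M ∸ a) a) ⟩
    fold x φ ((M ∸ a) + (d + a))        ≡⟨ cong (λ k → fold x φ ((M ∸ a) + k)) (m∸n+n≡m a≤b) ⟩
    fold x φ ((M ∸ a) + b)              ≡⟨ fold-+ x φ (M ∸ a) ⟩
    fold (fold x φ b) φ (M ∸ a)         ≡⟨ cong (λ y → fold y φ (M ∸ a)) (sym φᵃ≡φᵇ) ⟩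
    fold (fold x φ a) φ (M ∸ a)         ≡⟨ sym (fold-+ x φ (M ∸ a)) ⟩
    fold x φ ((M ∸ a) + a)              ≡⟨ cong (fold x φ) (m∸n+n≡m a≤M) ⟩
    fold x φ M                          ≡⟨ fold-periodic a≤b φᵃ≡φᵇ t N a≤N ⟩
    fold x φ N                          ∎
    where
    open ≡-Reasoning
    d M : ℕ
    d = b ∸ a
    M = t * d + N
    a≤M : a ≤ M
    a≤M = ≤-trans a≤N (m≤n+m N (t * d))

n≤n! : ∀ n → n ≤ n !
n≤n! zero    = z≤n
n≤n! (suc n) = ∣⇒≤ {{(suc n) !≢0}} (m∣m*n (n !))

n∣n! : ∀ {n} → 1 ≤ n → n ∣ n !
n∣n! {suc n} _ = m∣m*n (n !)

fold-!-idempotent : ∀ {m} (φ : Fin m → Fin m) x → fold x φ (m ! + m !) ≡ fold x φ (m !)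
fold-!-idempotent {m} φ x with pigeonhole (n<1+n m) (λ i → fold x φ (toℕ i))
... | i , j , i<j , φⁱ≡φʲ with ∣-trans (n∣n! (m<n⇒0<n∸m i<j)) (m≤n⇒m!∣n! d≤m)
  where
  d≤m : toℕ j ∸ toℕ i ≤ m
  d≤m = ≤-trans (m∸n≤m (toℕ j) (toℕ i)) (≤-pred (toℕ<n j))
... | divides k m!≡k*d = begin
  fold x φ (m ! + m !)                        ≡⟨ cong (λ c → fold x φ (c + m !)) m!≡k*d ⟩
  fold x φ (k * (toℕ j ∸ toℕ i) + m !)        ≡⟨ fold-periodic φ x (<⇒≤ i<j) φⁱ≡φʲ k (m !) i≤m! ⟩
  fold x φ (m !)                              ∎
  where
  open ≡-Reasoning
  i≤m! : toℕ i ≤ m !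
  i≤m! = ≤-trans (<⇒≤ i<j) (≤-trans (≤-pred (toℕ<n j)) (n≤n! m))

power-!-idempotent : ∀ {m n} (δ : Fin m → Fin n → Fin m) q v →
  Runs.run δ q (power (m !) v ++ power (m !) v) ≡ Runs.run δ q (power (m !) v)
power-!-idempotent {m} δ q v = begin
  run q (power (m !) v ++ power (m !) v)   ≡⟨ cong (run q) (power-+ (m !) (m !) v) ⟨
  run q (power (m ! + m !) v)              ≡⟨ run-power q v (m ! + m !) ⟩
  fold q (λ p → run p v) (m ! + m !)       ≡⟨ fold-!-idempotent (λ p → run p v) q ⟩
  fold q (λ p → run p v) (m !)             ≡⟨ run-power q v (m !) ⟨
  run q (power (m !) v)                    ∎
  where
  open ≡-Reasoning
  open Runs δ

lasso : ∀ {A : Set} → List A → A → List A → ℕ → A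
lasso x a as = prepend x (cycle a as)

MinEven : List ℕ → Set
MinEven cs = ∃[ c ] (2 ∣ c × c ∈ cs × All (c ≤_) cs)

MinEven-++ : ∀ cs ds → MinEven cs → MinEven ds → MinEven (cs ++ ds)
MinEven-++ cs ds (c , 2∣c , c∈cs , c≤cs) (d , 2∣d , d∈ds , d≤ds) with ≤-total c d
... | inj₁ c≤d = c , 2∣c , ++⁺ˡ c∈cs , ++⁺ (c≤cs) (All.map (≤-trans c≤d) d≤ds)
... | inj₂ d≤c = d , 2∣d , ++⁺ʳ cs d∈ds , ++⁺ (All.map (≤-trans d≤c) c≤cs) d≤ds

module Parity {m n : ℕ} (D : DPA m n) where
  open DPA D
  open Runs δ public

  startingAt : Fin m → DPA m n
  startingAt q = record D { init = q }

  colorFrom : Fin m → Word n → ℕ → ℕ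
  colorFrom q = colorAt (startingAt q)

  runFrom-suc : ∀ q w p → dpaRun (startingAt q) w (suc p) ≡ dpaRun (startingAt (δ q (w 0))) (λ i → w (suc i)) p
  runFrom-suc q w zero    = refl
  runFrom-suc q w (suc p) = cong (λ r → δ r (w (suc p))) (runFrom-suc q w p)

  colorFrom-suc : ∀ q w p → colorFrom q w (suc p) ≡ colorFrom (δ q (w 0)) (λ i → w (suc i)) p
  colorFrom-suc q w p = cong (λ r → color r (w (suc p))) (runFrom-suc q w p)

  runFrom-cong : ∀ q {w w′} → (∀ i → w i ≡ w′ i) →
                 ∀ p → dpaRun (startingAt q) w p ≡ dpaRun (startingAt q) w′ p
  runFrom-cong q w≗w′ zero    = refl
  runFrom-cong q w≗w′ (suc p) = cong₂ δ (runFrom-cong q w≗w′ p) (w≗w′ p)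

  colorFrom-cong : ∀ q {w w′} → (∀ i → w i ≡ w′ i) → ∀ p → colorFrom q w p ≡ colorFrom q w′ p
  colorFrom-cong q w≗w′ p = cong₂ color (runFrom-cong q w≗w′ p) (w≗w′ p)

  runFrom-prepend : ∀ q u f p → dpaRun (startingAt q) (prepend u f) (length u + p) ≡ dpaRun (startingAt (run q u)) f p
  runFrom-prepend q []      f p = refl
  runFrom-prepend q (a ∷ u) f p =
    trans (runFrom-suc q (prepend (a ∷ u) f) (length u + p)) (runFrom-prepend (δ q a) u f p)

  colorFrom-prepend : ∀ q u f p → colorFrom q (prepend u f) (length u + p) ≡ colorFrom (run q u) f p
  colorFrom-prepend q u f p = cong₂ color (runFrom-prepend q u f p) (prepend-+ u f p)

  loopColors : Fin m → List (Fin n) → List ℕ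
  loopColors q []      = []
  loopColors q (a ∷ u) = color q a ∷ loopColors (δ q a) u

  loopColors-++ : ∀ q u v → loopColors q (u ++ v) ≡ loopColors q u ++ loopColors (run q u) v
  loopColors-++ q []      v = refl
  loopColors-++ q (a ∷ u) v = cong (color q a ∷_) (loopColors-++ (δ q a) u v)

  MinEven-loop-++ : ∀ q u v → run q u ≡ q →
                    MinEven (loopColors q u) → MinEven (loopColors q v) → MinEven (loopColors q (u ++ v))
  MinEven-loop-++ q u v u-loops minᵘ minᵛ =
    subst MinEven (sym (trans (loopColors-++ q u v) (cong (λ p → loopColors q u ++ loopColors p v) u-loops)))
      (MinEven-++ _ _ minᵘ minᵛ)

  module _ {P : ℕ → Set} where

    All-loopColors⁻ : ∀ q u f {r} → All P (loopColors q u) → r < length u → P (colorFrom q (prepend u f) r)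
    All-loopColors⁻ q (a ∷ u) f {zero}  (pa ∷ _)  _         = pa
    All-loopColors⁻ q (a ∷ u) f {suc r} (_  ∷ pu) (s≤s r<u) =
      subst P (sym (colorFrom-suc q (prepend (a ∷ u) f) r)) (All-loopColors⁻ (δ q a) u f pu r<u)

    All-loopColors⁺ : ∀ q u f → (∀ r → r < length u → P (colorFrom q (prepend u f) r)) → All P (loopColors q u)
    All-loopColors⁺ q []      f pr = []
    All-loopColors⁺ q (a ∷ u) f pr = pr 0 (s≤s z≤n) ∷ All-loopColors⁺ (δ q a) u f
      (λ r r<u → subst P (colorFrom-suc q (prepend (a ∷ u) f) r) (pr (suc r) (s≤s r<u)))

  module _ {c : ℕ} where

    ∈-loopColors⁻ : ∀ q u f → c ∈ loopColors q u → ∃[ r ] (r < length u × c ≡ colorFrom q (prepend u f) r)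
    ∈-loopColors⁻ q (a ∷ u) f (here c≡)     = 0 , s≤s z≤n , c≡
    ∈-loopColors⁻ q (a ∷ u) f (there c∈) with ∈-loopColors⁻ (δ q a) u f c∈
    ... | r , r<u , c≡ = suc r , s≤s r<u , trans c≡ (sym (colorFrom-suc q (prepend (a ∷ u) f) r))

    ∈-loopColors⁺ : ∀ q u f {r} → r < length u → c ≡ colorFrom q (prepend u f) r → c ∈ loopColors q u
    ∈-loopColors⁺ q (a ∷ u) f {zero}  _         c≡ = here c≡
    ∈-loopColors⁺ q (a ∷ u) f {suc r} (s≤s r<u) c≡ =
      there (∈-loopColors⁺ (δ q a) u f r<u (trans c≡ (colorFrom-suc q (prepend (a ∷ u) f) r)))

  module Lasso (x : List (Fin n)) (a : Fin n) (as : List (Fin n))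
               (loop : run (run init x) (a ∷ as) ≡ run init x) where
    s : Fin m
    s = run init x
    g w : Word n
    g = cycle a as
    w = lasso x a as

    colors-periodic : ∀ p → colorFrom s g (length (a ∷ as) + p) ≡ colorFrom s g p
    colors-periodic p = cong₂ color runs-periodic (cycle-periodic a as p)
      where
      runs-periodic : dpaRun (startingAt s) g (length (a ∷ as) + p) ≡ dpaRun (startingAt s) g p
      runs-periodic = trans (runFrom-cong s (cycle-unfold a as) (length (a ∷ as) + p))
                        (trans (runFrom-prepend s (a ∷ as) g p) (cong (λ q → dpaRun (startingAt q) g p) loop))

    open Periodic (colorFrom s g) (length as) colors-periodic

    colorAt-lasso : ∀ p → colorAt D w (length x + p) ≡ colorFrom s g p
    colorAt-lasso = colorFrom-prepend init x g

    colorAt-lasso′ : ∀ j → length x ≤ j → colorAt D w j ≡ colorFrom s g (j ∸ length x)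
    colorAt-lasso′ j x≤j = trans (cong (colorAt D w) (sym (m+[n∸m]≡n x≤j))) (colorAt-lasso (j ∸ length x))

    loopColor : ∀ r → colorFrom s g r ≡ colorFrom s (prepend (a ∷ as) g) r
    loopColor = colorFrom-cong s (cycle-unfold a as)

    accepts⇒MinEven : DPAAccepts D w → MinEven (loopColors s (a ∷ as))
    accepts⇒MinEven (c , 2∣c , often , N , c≤) with often (length x + N)
    ... | j , x+N≤j , colorʲ≡c with residue (j ∸ length x)
    ...   | r , r<P , colorʲ≡colorʳ = c , 2∣c , c∈ , c≤loop
      where
      c∈ : c ∈ loopColors s (a ∷ as)
      c∈ = ∈-loopColors⁺ s (a ∷ as) g r<P
             (trans (sym colorʲ≡c) (trans (colorAt-lasso′ j (≤-trans (m≤m+n (length x) N) x+N≤j))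
                    (trans colorʲ≡colorʳ (loopColor r))))
      c≤loop : All (c ≤_) (loopColors s (a ∷ as))
      c≤loop = All-loopColors⁺ s (a ∷ as) g λ r _ →
        subst (c ≤_) (trans (colorAt-lasso (N * P + r)) (trans (periodic-* N r) (loopColor r)))
          (c≤ (length x + (N * P + r)) (t≤x+[t*P+r] (length x) N r))

    MinEven⇒accepts : MinEven (loopColors s (a ∷ as)) → DPAAccepts D w
    MinEven⇒accepts (c , 2∣c , c∈ , c≤loop) with ∈-loopColors⁻ s (a ∷ as) g c∈
    ... | r , r<P , c≡colorʳ = c , 2∣c , often , length x , c≤
      where
      often : InfinitelyOften (λ i → colorAt D w i ≡ c)
      often i = length x + (i * P + r) , t≤x+[t*P+r] (length x) i r
              , trans (colorAt-lasso (i * P + r)) (trans (periodic-* i r) (trans (loopColor r) (sym c≡colorʳ)))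
      c≤ : ∀ j → length x ≤ j → c ≤ colorAt D w j
      c≤ j x≤j with residue (j ∸ length x)
      ... | r′ , r′<P , colorʲ≡colorʳ′ =
        subst (c ≤_) (sym (trans (colorAt-lasso′ j x≤j) (trans colorʲ≡colorʳ′ (loopColor r′))))
          (All-loopColors⁻ s (a ∷ as) g c≤loop r′<P)

RepeatAt : ∀ {n} → Word n → Fin n → ℕ → Set
RepeatAt w a p = w p ≡ a × w (suc p) ≡ a

L : (n : ℕ) → Language n
L n w = ∃[ a ] (InfinitelyOften (λ p → w p ≡ a) × Eventually (λ p → ¬ RepeatAt w a p))

module LassoLetters {n : ℕ} (x : List (Fin n)) (a : Fin n) (as : List (Fin n)) where
  g w : Word n
  g = cycle a as
  w = lasso x a as

  open Periodic g (length as) (cycle-periodic a as)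

  lasso-periodic : ∀ t r → w (length x + (t * P + r)) ≡ g r
  lasso-periodic t r = trans (prepend-+ x g (t * P + r)) (periodic-* t r)

  lasso-periodic-suc : ∀ t r → w (suc (length x + (t * P + r))) ≡ g (suc r)
  lasso-periodic-suc t r =
    trans (cong w (trans (sym (+-suc (length x) _)) (cong (length x +_) (sym (+-suc (t * P) r)))))
          (lasso-periodic t (suc r))

  lasso-pair : ∀ j → length x ≤ j → ∃[ r ] (r < P × w j ≡ g r × w (suc j) ≡ g (suc r))
  lasso-pair j x≤j with split (j ∸ length x)
  ... | t , r , r<P , j-x≡ = r , r<P , trans (cong w j≡) (lasso-periodic t r) ,
                             trans (cong (w ∘ suc) j≡) (lasso-periodic-suc t r)
    where
    j≡ : j ≡ length x + (t * P + r)
    j≡ = trans (sym (m+[n∸m]≡n x≤j)) (cong (length x +_) j-x≡)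

  lasso∈L : ¬ Adj a a ((a ∷ as) ++ [ a ]) → L n w
  lasso∈L ¬aa = a , often , length x , ¬aaʲ
    where
    often : InfinitelyOften (λ p → w p ≡ a)
    often i = length x + (i * P + 0) , t≤x+[t*P+r] (length x) i 0 , lasso-periodic i 0
    ¬aaʲ : ∀ j → length x ≤ j → ¬ RepeatAt w a j
    ¬aaʲ j x≤j (wʲ≡a , wʲ⁺¹≡a) with lasso-pair j x≤j
    ... | r , r<P , wʲ≡gʳ , wʲ⁺¹≡gʳ⁺¹ =
      ¬aa (subst₂ (λ b c → Adj b c ((a ∷ as) ++ [ a ]))
                  (trans (sym wʲ≡gʳ) wʲ≡a) (trans (sym wʲ⁺¹≡gʳ⁺¹) wʲ⁺¹≡a)
                  (cycle-Adj a as r<P))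

  lasso∉L : All (λ b → Adj b b (a ∷ as)) (a ∷ as) → ¬ L n w
  lasso∉L doubled (b , often , N , ¬bb) with often (length x + N)
  ... | j , x+N≤j , wʲ≡b with lasso-pair j (≤-trans (m≤m+n (length x) N) x+N≤j)
  ... | r , r<P , wʲ≡gʳ , _ with Adj⇒prepend (subst (λ c → Adj c c (a ∷ as)) gʳ≡b bb)
    where
    gʳ≡b : prepend (a ∷ as) g r ≡ b
    gʳ≡b = trans (sym (cycle-unfold a as r)) (trans (sym wʲ≡gʳ) wʲ≡b)
    bb : Adj (prepend (a ∷ as) g r) (prepend (a ∷ as) g r) (a ∷ as)
    bb = All-prepend (a ∷ as) g doubled r<P
  ... | r′ , _ , at = ¬bb (length x + (N * P + r′)) (t≤x+[t*P+r] (length x) N r′)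
    ( trans (lasso-periodic N r′) (trans (cycle-unfold a as r′) (proj₁ (at g)))
    , trans (lasso-periodic-suc N r′) (trans (cycle-unfold a as (suc r′)) (proj₂ (at g))))

doubled : ∀ {n k} → (Fin k → Fin n) → List (Fin n)
doubled {k = zero}  T = []
doubled {k = suc k} T = T zero ∷ T zero ∷ doubled (T ∘ suc)

Adj-doubled : ∀ {n k} (T : Fin k → Fin n) y → Adj (T y) (T y) (doubled T)
Adj-doubled T zero    = here
Adj-doubled T (suc y) = there (there (Adj-doubled (T ∘ suc) y))

All-doubled : ∀ {n k} {P : Fin n → Set} (T : Fin k → Fin n) → (∀ y → P (T y)) → All P (doubled T)
All-doubled {k = zero}  T P∘T = []
All-doubled {k = suc k} T P∘T = P∘T zero ∷ P∘T zero ∷ All-doubled (T ∘ suc) (P∘T ∘ suc)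

-- Fin (k !) indexes the orderings of the k letters T: remQuot splits off the first letter c
-- and an ordering of the remaining ones, whose letters are T ∘ punchIn c.
module Witness (e : ℕ) {n : ℕ} where

  mutual
    witness : ∀ {k} → (Fin k → Fin n) → Fin (k !) → List (Fin n)
    witness {zero}  T i = []
    witness {suc k} T i = block T (remQuot {suc k} (k !) i)

    block : ∀ {k} → (Fin (suc k) → Fin n) → Fin (suc k) × Fin (k !) → List (Fin n)
    block T (c , r) = power (suc e) (blockBase T (c , r))

    blockBase : ∀ {k} → (Fin (suc k) → Fin n) → Fin (suc k) × Fin (k !) → List (Fin n)
    blockBase T (c , r) = T c ∷ doubled (T ∘ punchIn c) ++ witness (T ∘ punchIn c) r

  mutual
    All-witness : ∀ {k} {P : Fin n → Set} (T : Fin k → Fin n) i → (∀ y → P (T y)) → All P (witness T i)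
    All-witness {zero}  T i P∘T = []
    All-witness {suc k} T i P∘T = All-block T (remQuot {suc k} (k !) i) P∘T

    All-block : ∀ {k} {P : Fin n → Set} (T : Fin (suc k) → Fin n) p → (∀ y → P (T y)) → All P (block T p)
    All-block T p P∘T = All-power (suc e) (All-blockBase T p P∘T)

    All-blockBase : ∀ {k} {P : Fin n → Set} (T : Fin (suc k) → Fin n) p → (∀ y → P (T y)) → All P (blockBase T p)
    All-blockBase T (c , r) P∘T =
      P∘T c ∷ ++⁺ (All-doubled (T ∘ punchIn c) (P∘T ∘ punchIn c))
                  (All-witness (T ∘ punchIn c) r (P∘T ∘ punchIn c))

  Adj-block : ∀ {k} (T : Fin (suc k) → Fin n) c r {y} → y ≢ c → Adj (T y) (T y) (block T (c , r))
  Adj-block T c r y≢c = Adj-++ˡ (power e (blockBase T (c , r)))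
    (there (Adj-++ˡ (witness (T ∘ punchIn c) r)
      (subst (λ z → Adj (T z) (T z) (doubled (T ∘ punchIn c))) (punchIn-punchOut (y≢c ∘ sym))
        (Adj-doubled (T ∘ punchIn c) (punchOut (y≢c ∘ sym))))))

  blockTail : ∀ {k} → (Fin (suc k) → Fin n) → Fin (suc k) × Fin (k !) → List (Fin n)
  blockTail T (c , r) = (doubled (T ∘ punchIn c) ++ witness (T ∘ punchIn c) r) ++ power e (blockBase T (c , r))

  block-lasso∈L : ∀ {k} (T : Fin (suc (suc k)) → Fin n) → Injective _≡_ _≡_ T → ∀ c r x →
                  L n (lasso x (T c) (blockTail T (c , r)))
  block-lasso∈L T T-inj c r x = LassoLetters.lasso∈L x (T c) _ (¬Adj-power (suc e) (head T-c-fresh) (tail T-c-fresh))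
    where
    T-c-fresh : All (_≢ T c) (doubled (T ∘ punchIn c) ++ witness (T ∘ punchIn c) r)
    T-c-fresh = ++⁺ (All-doubled (T ∘ punchIn c) fresh) (All-witness (T ∘ punchIn c) r fresh)
      where
      fresh : ∀ y → T (punchIn c y) ≢ T c
      fresh y = punchInᵢ≢i c y ∘ T-inj

  blocks-doubled : ∀ {k} (T : Fin (suc k) → Fin n) {c₁ c₂} r₁ r₂ → c₁ ≢ c₂ →
                   let ℓ = block T (c₁ , r₁) ++ block T (c₂ , r₂) in All (λ b → Adj b b ℓ) ℓ
  blocks-doubled T {c₁} {c₂} r₁ r₂ c₁≢c₂ =
    ++⁺ (All-block T (c₁ , r₁) T-doubled) (All-block T (c₂ , r₂) T-doubled)
    where
    T-doubled : ∀ y → Adj (T y) (T y) (block T (c₁ , r₁) ++ block T (c₂ , r₂))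
    T-doubled y with y ≟ c₁
    ... | yes refl = Adj-++ʳ (block T (c₁ , r₁)) (Adj-block T c₂ r₂ c₁≢c₂)
    ... | no y≢c₁  = Adj-++ˡ (block T (c₂ , r₂)) (Adj-block T c₁ r₁ y≢c₁)

  block-split : ∀ {k} (T : Fin (suc k) → Fin n) c r x →
    x ++ block T (c , r) ≡
    (x ++ power e (blockBase T (c , r)) ++ T c ∷ doubled (T ∘ punchIn c)) ++ witness (T ∘ punchIn c) r
  block-split {k} T c r x = begin
    x ++ power (suc e) v                            ≡⟨ cong (x ++_) (power-suc e v) ⟩
    x ++ (power e v ++ v)                           ≡⟨ cong (x ++_) (++-assoc (power e v) (T c ∷ doubled T′) rest) ⟨
    x ++ ((power e v ++ T c ∷ doubled T′) ++ rest)  ≡⟨ ++-assoc x (power e v ++ T c ∷ doubled T′) rest ⟨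
    (x ++ power e v ++ T c ∷ doubled T′) ++ rest    ∎
    where
    open ≡-Reasoning
    T′ : Fin k → Fin n
    T′ = T ∘ punchIn c
    v rest : List (Fin n)
    v = blockBase T (c , r)
    rest = witness T′ r

module LowerBound {m n : ℕ} (D : DPA m n) (recognizes : DPARecognizes D (L n)) where
  open DPA D using (init; δ)
  open Parity D
  open Equivalence

  e : ℕ
  e = pred (m !)

  open Witness e

  e+1≡m! : suc e ≡ m !
  e+1≡m! = suc-pred (m !) {{m !≢0}}

  loops-after-power : ∀ x v → run (run init (x ++ power (suc e) v)) (power (suc e) v) ≡ run init (x ++ power (suc e) v)
  loops-after-power x v = begin
    run (run init (x ++ V)) V   ≡⟨ run-++ init (x ++ V) V ⟨
    run init ((x ++ V) ++ V)    ≡⟨ cong (run init) (++-assoc x V V) ⟩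
    run init (x ++ (V ++ V))    ≡⟨ run-++ init x (V ++ V) ⟩
    run (run init x) (V ++ V)   ≡⟨ subst (λ E → run (run init x) (power E v ++ power E v) ≡ run (run init x) (power E v))
                                         (sym e+1≡m!) (power-!-idempotent δ (run init x) v) ⟩
    run (run init x) V          ≡⟨ run-++ init x V ⟨
    run init (x ++ V)           ∎
    where
    open ≡-Reasoning
    V : List (Fin n)
    V = power (suc e) v

  -- Two blocks with different head letters leading to the same state s both loop at s; each loop alone
  -- spells a word of L, so both have even minimal colour, hence so does the combined loop, whose letters
  -- all occur doubled: that word is accepted but not in L.
  different-heads-separate : ∀ {k} (T : Fin (suc (suc k)) → Fin n) → Injective _≡_ _≡_ T →
    ∀ {c₁ c₂} r₁ r₂ → c₁ ≢ c₂ → ∀ x₁ x₂ →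
    run init (x₁ ++ block T (c₁ , r₁)) ≢ run init (x₂ ++ block T (c₂ , r₂))
  different-heads-separate T T-inj {c₁} {c₂} r₁ r₂ c₁≢c₂ x₁ x₂ same-state =
    LassoLetters.lasso∉L X (T c₁) (blockTail T (c₁ , r₁) ++ ℓ₂) (blocks-doubled T r₁ r₂ c₁≢c₂)
      (from (recognizes _) (Lasso.MinEven⇒accepts X (T c₁) (blockTail T (c₁ , r₁) ++ ℓ₂) loop₁₂
        (MinEven-loop-++ s ℓ₁ ℓ₂ loop₁ (block-MinEven c₁ r₁ loop₁) (block-MinEven c₂ r₂ loop₂))))
    where
    ℓ₁ ℓ₂ X : List (Fin n)
    ℓ₁ = block T (c₁ , r₁)
    ℓ₂ = block T (c₂ , r₂)
    X = x₁ ++ ℓ₁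
    s : Fin m
    s = run init X
    loop₁ : run s ℓ₁ ≡ s
    loop₁ = loops-after-power x₁ (blockBase T (c₁ , r₁))
    loop₂ : run s ℓ₂ ≡ s
    loop₂ = subst (λ q → run q ℓ₂ ≡ q) (sym same-state) (loops-after-power x₂ (blockBase T (c₂ , r₂)))
    loop₁₂ : run s (ℓ₁ ++ ℓ₂) ≡ s
    loop₁₂ = trans (run-++ s ℓ₁ ℓ₂) (trans (cong (λ q → run q ℓ₂) loop₁) loop₂)
    block-MinEven : ∀ c r → run s (block T (c , r)) ≡ s → MinEven (loopColors s (block T (c , r)))
    block-MinEven c r loops = Lasso.accepts⇒MinEven X (T c) (blockTail T (c , r)) loops
                                (to (recognizes _) (block-lasso∈L T T-inj c r X))

  Separates : {I : Set} → (I → List (Fin n)) → Set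
  Separates f = ∀ i j x₁ x₂ → run init (x₁ ++ f i) ≡ run init (x₂ ++ f j) → i ≡ j

  block-separates : ∀ {k} (T : Fin (suc k) → Fin n) → Injective _≡_ _≡_ T →
                    (∀ c → Separates (witness (T ∘ punchIn c))) → Separates (block T)
  block-separates {zero}  T T-inj _ (zero , zero) (zero , zero) x₁ x₂ _ = refl
  block-separates {suc k} T T-inj witness-separates (c₁ , r₁) (c₂ , r₂) x₁ x₂ same-state with c₁ ≟ c₂
  ... | no c₁≢c₂ = ⊥-elim (different-heads-separate T T-inj r₁ r₂ c₁≢c₂ x₁ x₂ same-state)
  ... | yes refl = cong (c₁ ,_) (witness-separates c₁ r₁ r₂ (x₁ ++ prefix r₁) (x₂ ++ prefix r₂)
                     (trans (cong (run init) (sym (block-split T c₁ r₁ x₁)))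
                       (trans same-state (cong (run init) (block-split T c₁ r₂ x₂)))))
    where
    prefix : Fin (suc k !) → List (Fin n)
    prefix r = power e (blockBase T (c₁ , r)) ++ T c₁ ∷ doubled (T ∘ punchIn c₁)

  witness-separates : ∀ {k} (T : Fin k → Fin n) → Injective _≡_ _≡_ T → Separates (witness T)
  witness-separates {zero}  T T-inj zero zero x₁ x₂ _ = refl
  witness-separates {suc k} T T-inj i j x₁ x₂ same-state = begin
    i                                         ≡⟨ combine-remQuot {suc k} (k !) i ⟨
    uncurry combine (remQuot {suc k} (k !) i) ≡⟨ cong (uncurry combine) remQuot-i≡remQuot-j ⟩
    uncurry combine (remQuot {suc k} (k !) j) ≡⟨ combine-remQuot {suc k} (k !) j ⟩
    j                                         ∎
    where
    open ≡-Reasoning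
    remQuot-i≡remQuot-j : remQuot {suc k} (k !) i ≡ remQuot (k !) j
    remQuot-i≡remQuot-j = block-separates T T-inj
      (λ c → witness-separates (T ∘ punchIn c) (punchIn-injective c _ _ ∘ T-inj)) _ _ x₁ x₂ same-state

  n!≤m : n ! ≤ m
  n!≤m = ≮⇒≥ λ m<n! → let i , j , i<j , same-state = pigeonhole m<n! (λ i → run init (witness id i)) in
    <-irrefl (cong toℕ (witness-separates id id i j [] [] same-state)) i<j

dpa-needs-n!-states : ∀ n m → m < n ! → (D : DPA m n) → ¬ DPARecognizes D (L n)
dpa-needs-n!-states n m m<n! D recognizes = <⇒≱ m<n! (LowerBound.n!≤m D recognizes)

-- the deterministic part: wait a watches for the letter a, hit a has just read it
data Det (n : ℕ) : Set where
  dead     : Det n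
  wait hit : Fin n → Det n

module _ {n : ℕ} where

  next : Det n → Fin n → Det n
  next dead     b = dead
  next (wait a) b with b ≟ a
  ... | yes _ = hit a
  ... | no  _ = wait a
  next (hit a)  b with b ≟ a
  ... | yes _ = dead
  ... | no  _ = wait a

  next-wait-≡ : ∀ a → next (wait a) a ≡ hit a
  next-wait-≡ a with a ≟ a
  ... | yes _   = refl
  ... | no  a≢a = ⊥-elim (a≢a refl)

  next-wait-≢ : ∀ {a b} → b ≢ a → next (wait a) b ≡ wait a
  next-wait-≢ {a} {b} b≢a with b ≟ a
  ... | yes b≡a = ⊥-elim (b≢a b≡a)
  ... | no  _   = refl

  next-hit-≢ : ∀ {a b} → b ≢ a → next (hit a) b ≡ wait a
  next-hit-≢ {a} {b} b≢a with b ≟ a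
  ... | yes b≡a = ⊥-elim (b≢a b≡a)
  ... | no  _   = refl

  trace : Det n → Word n → ℕ → Det n
  trace d u zero    = d
  trace d u (suc p) = next (trace d u p) (u p)

  data Tracks (a : Fin n) : Det n → Set where
    wait : Tracks a (wait a)
    hit  : Tracks a (hit a)
    dead : Tracks a dead

  next-Tracks : ∀ {a d} b → Tracks a d → Tracks a (next d b)
  next-Tracks {a} b wait with b ≟ a
  ... | yes _ = hit
  ... | no  _ = wait
  next-Tracks {a} b hit with b ≟ a
  ... | yes _ = dead
  ... | no  _ = wait
  next-Tracks b dead = dead

  Tracks-trace : ∀ a u p → Tracks a (trace (wait a) u p)
  Tracks-trace a u zero    = wait
  Tracks-trace a u (suc p) = next-Tracks (u p) (Tracks-trace a u p)

  Tracks-aa-dead : ∀ {a d} → Tracks a d → next (next d a) a ≡ dead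
  Tracks-aa-dead {a} wait rewrite next-wait-≡ a with a ≟ a
  ... | yes _   = refl
  ... | no  a≢a = ⊥-elim (a≢a refl)
  Tracks-aa-dead {a} hit with a ≟ a
  ... | yes _   = refl
  ... | no  a≢a = ⊥-elim (a≢a refl)
  Tracks-aa-dead dead = refl

  trace-dead : ∀ d u p → trace d u p ≡ dead → ∀ k → trace d u (k + p) ≡ dead
  trace-dead d u p dead-at-p zero    = dead-at-p
  trace-dead d u p dead-at-p (suc k) = cong (λ d′ → next d′ (u (k + p))) (trace-dead d u p dead-at-p k)

  trace-repeat : ∀ a u p → RepeatAt u a p → ∀ i → suc (suc p) ≤ i → trace (wait a) u i ≡ dead
  trace-repeat a u p (uᵖ≡a , uᵖ⁺¹≡a) i p+2≤i = subst (λ j → trace (wait a) u j ≡ dead) (m∸n+n≡m p+2≤i)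
    (trace-dead (wait a) u (suc (suc p)) dead-at-p+2 (i ∸ suc (suc p)))
    where
    dead-at-p+2 : trace (wait a) u (suc (suc p)) ≡ dead
    dead-at-p+2 rewrite uᵖ≡a | uᵖ⁺¹≡a = Tracks-aa-dead (Tracks-trace a u p)

  trace-no-repeat : ∀ a u → (∀ p → ¬ RepeatAt u a p) →
                    ∀ p → trace (wait a) u (suc p) ≡ next (wait a) (u p)
  trace-no-repeat a u no-aa zero    = refl
  trace-no-repeat a u no-aa (suc p) with u p ≟ a
  ... | no uᵖ≢a rewrite trace-no-repeat a u no-aa p | next-wait-≢ uᵖ≢a = refl
  ... | yes uᵖ≡a rewrite trace-no-repeat a u no-aa p | uᵖ≡a | next-wait-≡ a =
    trans (next-hit-≢ uᵖ⁺¹≢a) (sym (next-wait-≢ uᵖ⁺¹≢a))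
    where
    uᵖ⁺¹≢a : u (suc p) ≢ a
    uᵖ⁺¹≢a uᵖ⁺¹≡a = no-aa p (uᵖ≡a , uᵖ⁺¹≡a)

  trace-no-repeat-wait : ∀ a u → (∀ p → ¬ RepeatAt u a p) → ∀ p → u p ≡ a → trace (wait a) u p ≡ wait a
  trace-no-repeat-wait a u no-aa zero    _      = refl
  trace-no-repeat-wait a u no-aa (suc p) uᵖ⁺¹≡a =
    trans (trace-no-repeat a u no-aa p) (next-wait-≢ (λ uᵖ≡a → no-aa p (uᵖ≡a , uᵖ⁺¹≡a)))

data State (n : ℕ) : Set where
  start : State n
  det   : Det n → State n

does-true : ∀ {A : Set} (a? : Dec A) → does a? ≡ true → A
does-true (yes a) _ = a

∧-true : ∀ {x y} → x ∧ y ≡ true → x ≡ true × y ≡ true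
∧-true {true} {true} _ = refl , refl

module Automaton (n : ℕ) where
  K : ℕ
  K = 3 * n + 2

  -- Fin K is laid out as wait a, hit a, n spare codes, start, dead; the spare codes behave as dead.
  decodeDet : Fin (3 * n) → State n
  decodeDet q = [ det ∘ wait , [ det ∘ hit , (λ _ → det dead) ]′ ∘ splitAt n ]′ (splitAt n q)

  decodeLast : Fin 2 → State n
  decodeLast zero    = start
  decodeLast (suc _) = det dead

  decode : Fin K → State n
  decode q = [ decodeDet , decodeLast ]′ (splitAt (3 * n) q)

  code : State n → Fin K
  code start          = (3 * n) ↑ʳ zero
  code (det dead)     = (3 * n) ↑ʳ suc zero
  code (det (wait a)) = (a ↑ˡ (n + (n + 0))) ↑ˡ 2
  code (det (hit a))  = (n ↑ʳ (a ↑ˡ (n + 0))) ↑ˡ 2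

  decode-code : ∀ s → decode (code s) ≡ s
  decode-code start          rewrite splitAt-↑ʳ (3 * n) 2 zero = refl
  decode-code (det dead)     rewrite splitAt-↑ʳ (3 * n) 2 (suc zero) = refl
  decode-code (det (wait a)) rewrite splitAt-↑ˡ (3 * n) (a ↑ˡ (n + (n + 0))) 2
                                   | splitAt-↑ˡ n a (n + (n + 0)) = refl
  decode-code (det (hit a))  rewrite splitAt-↑ˡ (3 * n) (n ↑ʳ (a ↑ˡ (n + 0))) 2
                                   | splitAt-↑ʳ n (n + (n + 0)) (a ↑ˡ (n + 0))
                                   | splitAt-↑ˡ n a (n + 0) = refl

  fromStart : State n → Bool
  fromStart start          = true
  fromStart (det (wait _)) = true
  fromStart (det _)        = false

  step : State n → Fin n → Fin K → Bool
  step start   b q′ = fromStart (decode q′)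
  step (det d) b q′ = does (q′ ≟ code (det (next d b)))

  awaited : State n → Fin n → Bool
  awaited (det (wait a)) b = does (b ≟ a)
  awaited _              b = false

  step-next : ∀ d b → step (det d) b (code (det (next d b))) ≡ true
  step-next d b = dec-true (code (det (next d b)) ≟ code (det (next d b))) refl

  step-det : ∀ d b {q′} → step (det d) b q′ ≡ true → q′ ≡ code (det (next d b))
  step-det d b {q′} = does-true (q′ ≟ code (det (next d b)))

  step-start : ∀ s b → fromStart s ≡ true → step start b (code s) ≡ true
  step-start s b from-start = trans (cong fromStart (decode-code s)) from-start

  automaton : Buchi K n
  automaton = record
    { init  = code start
    ; δ     = λ q b → step (decode q) b
    ; α     = λ q b q′ → awaited (decode q) b ∧ step (decode q) b q′
    ; total = total
    ; α⊆δ   = λ q b q′ accepting → proj₂ (∧-true accepting)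
    }
    where
    total : ∀ q b → ∃[ q′ ] (step (decode q) b q′ ≡ true)
    total q b with decode q
    ... | start = code start , step-start start b refl
    ... | det d = code (det (next d b)) , step-next d b

  isDet : State n → Bool
  isDet start   = false
  isDet (det _) = true

  decode-step : ∀ d b {q′} → step (det d) b q′ ≡ true → decode q′ ≡ det (next d b)
  decode-step d b stepping = trans (cong decode (step-det d b stepping)) (decode-code _)

  limitDeterministic : LimitDeterministic automaton
  limitDeterministic = (λ q → isDet (decode q)) , α-det , step-unique , step-closed
    where
    det-after-step : ∀ d b {q′} → step (det d) b q′ ≡ true → isDet (decode q′) ≡ true
    det-after-step d b stepping = cong isDet (decode-step d b stepping)
    α-det : ∀ q b q′ → awaited (decode q) b ∧ step (decode q) b q′ ≡ true →
            isDet (decode q) ≡ true × isDet (decode q′) ≡ true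
    α-det q b q′ accepting with decode q
    ... | det (wait a) = refl , det-after-step (wait a) b (proj₂ (∧-true accepting))
    step-unique : ∀ q b q₁ q₂ → isDet (decode q) ≡ true →
                  step (decode q) b q₁ ≡ true → step (decode q) b q₂ ≡ true → q₁ ≡ q₂
    step-unique q b q₁ q₂ is-det with decode q
    ... | det d = λ step₁ step₂ → trans (step-det d b step₁) (sym (step-det d b step₂))
    step-closed : ∀ q b q′ → isDet (decode q) ≡ true → step (decode q) b q′ ≡ true → isDet (decode q′) ≡ true
    step-closed q b q′ is-det with decode q
    ... | det d = det-after-step d b

  Transition Accepting : State n → Fin n → State n → Set
  Transition s b s′ = Buchi.δ automaton (code s) b (code s′) ≡ true
  Accepting  s b s′ = Buchi.α automaton (code s) b (code s′) ≡ true

  transition-det : ∀ d b → Transition (det d) b (det (next d b))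
  transition-det d b rewrite decode-code (det d) = step-next d b

  transition-start : ∀ b s → fromStart s ≡ true → Transition start b s
  transition-start b s from-start rewrite decode-code start = step-start s b from-start

  accepting-wait : ∀ a → Accepting (det (wait a)) a (det (next (wait a) a))
  accepting-wait a rewrite decode-code (det (wait a)) | dec-true (a ≟ a) refl = step-next (wait a) a

  awaited-wait : ∀ s b → awaited s b ≡ true → ∃[ a ] (s ≡ det (wait a) × b ≡ a)
  awaited-wait (det (wait a)) b awaits = a , refl , does-true (b ≟ a) awaits

  -- start loops until position N, where the run guesses the letter a
  guessRun : Fin n → ℕ → Word n → ℕ → State n
  guessRun a zero    w zero    = start
  guessRun a zero    w (suc p) = det (trace (wait a) (λ i → w (suc i)) p)
  guessRun a (suc N) w zero    = start
  guessRun a (suc N) w (suc p) = guessRun a N (λ i → w (suc i)) p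

  guessRun-zero : ∀ a N w → guessRun a N w 0 ≡ start
  guessRun-zero a zero    w = refl
  guessRun-zero a (suc N) w = refl

  guessRun-transition : ∀ a N w p → Transition (guessRun a N w p) (w p) (guessRun a N w (suc p))
  guessRun-transition a zero          w zero    = transition-start (w 0) (det (wait a)) refl
  guessRun-transition a zero          w (suc p) = transition-det (trace (wait a) (λ i → w (suc i)) p) (w (suc p))
  guessRun-transition a (suc zero)    w zero    = transition-start (w 0) start refl
  guessRun-transition a (suc (suc N)) w zero    = transition-start (w 0) start refl
  guessRun-transition a (suc N)       w (suc p) = guessRun-transition a N (λ i → w (suc i)) p

  guessRun-late : ∀ a N w i → guessRun a N w (suc (N + i)) ≡ det (trace (wait a) (λ j → w (suc (N + j))) i)
  guessRun-late a zero    w i = refl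
  guessRun-late a (suc N) w i = guessRun-late a N (λ j → w (suc j)) i

  module GuessedRun (w : Word n) (a : Fin n) (often : InfinitelyOften (λ p → w p ≡ a))
    (N : ℕ) (no-aa : ∀ p → N ≤ p → ¬ RepeatAt w a p) where
    states : ℕ → State n
    states = guessRun a N w
    u : Word n
    u j = w (suc (N + j))
    no-aa-u : ∀ p → ¬ RepeatAt u a p
    no-aa-u p (uᵖ≡a , uᵖ⁺¹≡a) = no-aa (suc (N + p)) (≤-trans (m≤m+n N p) (n≤1+n _))
      (uᵖ≡a , trans (cong (λ k → w (suc k)) (sym (+-suc N p))) uᵖ⁺¹≡a)
    accepting-late : ∀ k → u k ≡ a → Accepting (states (suc (N + k))) (u k) (states (suc (suc (N + k))))
    accepting-late k uᵏ≡a =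
      subst₂ (λ s s′ → Accepting s (u k) s′) (sym (guessRun-late a N w k)) (sym late-suc) accepting-trace
      where
      late-suc : states (suc (suc (N + k))) ≡ det (next (trace (wait a) u k) (u k))
      late-suc = trans (cong (λ p → states (suc p)) (sym (+-suc N k))) (guessRun-late a N w (suc k))
      accepting-trace : Accepting (det (trace (wait a) u k)) (u k) (det (next (trace (wait a) u k) (u k)))
      accepting-trace rewrite trace-no-repeat-wait a u no-aa-u k uᵏ≡a | uᵏ≡a = accepting-wait a
    accepting-often : InfinitelyOften (λ i → Accepting (states i) (w i) (states (suc i)))
    accepting-often i with often (suc N + i)
    ... | j , N+i<j , wʲ≡a = j , ≤-trans (m≤n+m i (suc N)) N+i<j ,
      subst (λ p → Accepting (states p) (w p) (states (suc p))) (m+[n∸m]≡n N<j)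
        (accepting-late (j ∸ suc N) (trans (cong w (m+[n∸m]≡n N<j)) wʲ≡a))
      where
      N<j : suc N ≤ j
      N<j = ≤-trans (m≤m+n (suc N) i) N+i<j

  L⇒accepts : ∀ w → L n w → BuchiAccepts automaton w
  L⇒accepts w (a , often , N , no-aa) =
    (λ p → code (states p)) , (cong code (guessRun-zero a N w) , guessRun-transition a N w) , accepting-often
    where open GuessedRun w a often N no-aa

  module AcceptingRun (w : Word n) (r : ℕ → Fin K)
    (transitions : ∀ i → step (decode (r i)) (w i) (r (suc i)) ≡ true)
    (accepting-often : InfinitelyOften (λ i → awaited (decode (r i)) (w i) ∧ step (decode (r i)) (w i) (r (suc i)) ≡ true))
    where
    awaits : ∀ j → awaited (decode (r j)) (w j) ∧ step (decode (r j)) (w j) (r (suc j)) ≡ true →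
             ∃[ b ] (decode (r j) ≡ det (wait b) × w j ≡ b)
    awaits j accepting = awaited-wait (decode (r j)) (w j) (proj₁ (∧-true accepting))
    j₀ : ℕ
    j₀ = proj₁ (accepting-often 0)
    a : Fin n
    a = proj₁ (awaits j₀ (proj₂ (proj₂ (accepting-often 0))))
    v : Word n
    v i = w (j₀ + i)
    deterministic : ∀ i → decode (r (j₀ + i)) ≡ det (trace (wait a) v i)
    deterministic zero    = trans (cong (decode ∘ r) (+-identityʳ j₀))
                                  (proj₁ (proj₂ (awaits j₀ (proj₂ (proj₂ (accepting-often 0))))))
    deterministic (suc i) = trans (cong (decode ∘ r) (+-suc j₀ i)) (decode-step (trace (wait a) v i) (v i) transition)
      where
      transition : step (det (trace (wait a) v i)) (v i) (r (suc (j₀ + i))) ≡ true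
      transition = subst (λ s → step s (v i) (r (suc (j₀ + i))) ≡ true) (deterministic i) (transitions (j₀ + i))
    deterministic′ : ∀ j → j₀ ≤ j → decode (r j) ≡ det (trace (wait a) v (j ∸ j₀))
    deterministic′ j j₀≤j = trans (cong (decode ∘ r) (sym (m+[n∸m]≡n j₀≤j))) (deterministic (j ∸ j₀))
    accepting⇒a : ∀ j → j₀ ≤ j → awaited (decode (r j)) (w j) ∧ step (decode (r j)) (w j) (r (suc j)) ≡ true →
                  w j ≡ a × trace (wait a) v (j ∸ j₀) ≡ wait a
    accepting⇒a j j₀≤j accepting with awaits j accepting
    ... | b , sʲ≡wait-b , wʲ≡b
      with trace (wait a) v (j ∸ j₀) | Tracks-trace a v (j ∸ j₀) | trans (sym sʲ≡wait-b) (deterministic′ j j₀≤j)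
    ...   | .(wait a) | wait | refl = wʲ≡b , refl
    often : InfinitelyOften (λ p → w p ≡ a)
    often i with accepting-often (i ⊔ j₀)
    ... | j , i⊔j₀≤j , accepting = j , ≤-trans (m≤m⊔n i j₀) i⊔j₀≤j ,
                                   proj₁ (accepting⇒a j (≤-trans (m≤n⊔m i j₀) i⊔j₀≤j) accepting)
    no-aa : ∀ p → j₀ ≤ p → ¬ RepeatAt w a p
    no-aa p j₀≤p (wᵖ≡a , wᵖ⁺¹≡a) with accepting-often (suc (suc p))
    ... | j , p+2≤j , accepting with trans (sym (proj₂ (accepting⇒a j j₀≤j accepting))) dead-at-j
      where
      i : ℕ
      i = p ∸ j₀
      j₀≤j : j₀ ≤ j
      j₀≤j = ≤-trans j₀≤p (≤-trans (n≤1+n p) (≤-trans (n≤1+n (suc p)) p+2≤j))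
      vⁱ≡a : v i ≡ a
      vⁱ≡a = trans (cong w (m+[n∸m]≡n j₀≤p)) wᵖ≡a
      vⁱ⁺¹≡a : v (suc i) ≡ a
      vⁱ⁺¹≡a = trans (cong w (trans (+-suc j₀ i) (cong suc (m+[n∸m]≡n j₀≤p)))) wᵖ⁺¹≡a
      dead-at-j : trace (wait a) v (j ∸ j₀) ≡ dead
      dead-at-j = trace-repeat a v i (vⁱ≡a , vⁱ⁺¹≡a) (j ∸ j₀)
        (subst (_≤ j ∸ j₀) (+-∸-assoc 2 j₀≤p) (∸-monoˡ-≤ j₀ p+2≤j))
    ... | ()

  accepts⇒L : ∀ w → BuchiAccepts automaton w → L n w
  accepts⇒L w (r , (_ , transitions) , accepting-often) = a , often , j₀ , no-aa
    where open AcceptingRun w r transitions accepting-often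

  recognizes : BuchiRecognizes automaton (L n)
  recognizes w = mk⇔ (L⇒accepts w) (accepts⇒L w)

mainTheorem4 : Σ ((n : ℕ) → Language n) λ L →
                 ∀ n → 2 ≤ n →
                   (∃[ A ] (LimitDeterministic {3 * n + 2} {n} A × BuchiRecognizes A (L n)))
                   × (∀ m → m < n ! → (D : DPA m n) → ¬ DPARecognizes D (L n))
-- the construction works for every n
mainTheorem4 = L , λ n _ →
  (Automaton.automaton n , Automaton.limitDeterministic n , Automaton.recognizes n) , dpa-needs-n!-states n
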